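{- Let $H$ and $K$ be finite simplicial complexes. If $H<K$, then there exists an injective chain map $C_*(H;\mathbb{Z}_2)\to C_*(K;\mathbb{Z}_2)$ between the simplicial chain complexes with $\mathbb{Z}_2$ coefficients.
   Context: A set $T$ is a missing face of $K$ if $T\notin K$ but every proper subset of $T$ is in $K$. An admissible contraction $K\mapsto K'$ identifies two distinct vertices $u,v$ of $K$ such that no missing face of $K$ of dimension $\le\dim K$ contains both $u$ and $v$; explicitly $K'=\{T: u\notin T\in K\}\cup\{(T\setminus\{u\})\cup\{v\}: u\in T\in K\}$. A deletion $K\mapsto K'$ means $K'$ is a subcomplex of $K$. $H<K$ means $H$ is obtained from $K$ by a finite sequence of admissible contractions and deletions. -}

module Defs where

open import Data.Bool using (Bool; true; false; _xor_; if_then_else_)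
open import Data.Nat using (ℕ; suc; _≤_)
open import Data.Fin using (Fin)
open import Data.Fin.Subset using (Subset; _∈_; _∉_; _⊆_; _⊂_; ⁅_⁆; _∪_; _-_; ∣_∣)
open import Data.Vec using (lookup)
open import Data.List using (foldr; map)
open import Data.List using () renaming (allFin to allFinL)
open import Data.Product using (Σ; ∃; _×_)
open import Data.Sum using (_⊎_)
open import Relation.Nullary using (¬_; Dec)
open import Relation.Binary.PropositionalEquality using (_≡_; _≢_)
open import Relation.Binary.Construct.Closure.ReflexiveTransitive using (Star)
open import Function.Bundles using (_⇔_)

-- Every finite simplicial complex is (up to
-- relabelling) of this form for some n.

FaceSet : ℕ → Set₁
FaceSet n = Subset n → Set

record IsComplex {n : ℕ} (K : FaceSet n) : Set where
  field
    decide : ∀ σ → Dec (K σ)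
    downClosed : ∀ {σ τ} → τ ⊆ σ → K σ → K τ

MissingFace : ∀ {n} → FaceSet n → Subset n → Set
MissingFace K T = ¬ K T × (∀ S → S ⊂ T → K S)

-- dim T ≤ dim K, i.e. |T| - 1 ≤ max { |σ| - 1 : σ ∈ K }.
DimLe : ∀ {n} → Subset n → FaceSet n → Set
DimLe T K = ∃ λ σ → K σ × ∣ T ∣ ≤ ∣ σ ∣

Vertex : ∀ {n} → FaceSet n → Fin n → Set
Vertex K u = K ⁅ u ⁆

Admissible : ∀ {n} → FaceSet n → Fin n → Fin n → Set
Admissible K u v =
  Vertex K u × Vertex K v × u ≢ v ×
  (∀ T → MissingFace K T → DimLe T K → ¬ (u ∈ T × v ∈ T))

Contraction : ∀ {n} → FaceSet n → Fin n → Fin n → FaceSet n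
Contraction K u v T =
  (u ∉ T × K T) ⊎ (∃ λ S → u ∈ S × K S × T ≡ (S - u) ∪ ⁅ v ⁆)

data Move {n : ℕ} (K K' : FaceSet n) : Set where
  contract : ∀ u v → Admissible K u v →
             (∀ T → K' T ⇔ Contraction K u v T) → Move K K'
  delete   : IsComplex K' → (∀ T → K' T → K T) → Move K K'

_<_ : ∀ {n} → FaceSet n → FaceSet n → Set₁
H < K = Star Move K H

-- Simplicial chains with ℤ₂ = Bool (xor) coefficients.
-- A chain assigns a coefficient to every subset of Fin n; a k-chain of K
-- is supported on the k-faces (faces with k+1 vertices) of K.

Chain : ℕ → Set
Chain n = Subset n → Bool

_≈_ : ∀ {n} → Chain n → Chain n → Set
c ≈ d = ∀ σ → c σ ≡ d σ

_⊕_ : ∀ {n} → Chain n → Chain n → Chain n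
(c ⊕ d) σ = c σ xor d σ

IsChain : ∀ {n} → FaceSet n → ℕ → Chain n → Set
IsChain K k c = ∀ σ → c σ ≡ true → K σ × ∣ σ ∣ ≡ suc k

∂ : ∀ {n} → Chain n → Chain n
∂ {n} c σ = foldr _xor_ false
  (map (λ i → if lookup σ i then false else c (σ ∪ ⁅ i ⁆)) (allFinL n))

record ChainMap {n : ℕ} (H K : FaceSet n) : Set where
  field
    f : ℕ → Chain n → Chain n
    f-cong : ∀ k c d → IsChain H k c → IsChain H k d → c ≈ d → f k c ≈ f k d
    f-into : ∀ k c → IsChain H k c → IsChain K k (f k c)
    f-linear : ∀ k c d → IsChain H k c → IsChain H k d →
               f k (c ⊕ d) ≈ (f k c ⊕ f k d)
    f-commute : ∀ k c → IsChain H (suc k) c → f k (∂ c) ≈ ∂ (f (suc k) c)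

Injective : ∀ {n} {H K : FaceSet n} → ChainMap H K → Set
Injective {H = H} φ = ∀ k c d → IsChain H k c → IsChain H k d →
                      ChainMap.f φ k c ≈ ChainMap.f φ k d → c ≈ d

module Submission where

-- Deletions induce inclusions of chain complexes and injective chain maps compose, so it
-- suffices to treat a single admissible contraction K′ of K along u ↦ v.  The new faces of
-- K′, those not in K, all contain v, and their lifts (τ - v) ∪ {u} are faces of K.  Let h
-- cone each new face τ with u; then F = id + ∂h + h∂ commutes with ∂ because ∂∂ = 0.
-- On simplices avoiding u, F e is the restriction of e to K, and at the lift of a new face τ
-- it takes the value e τ; together these give injectivity.  That F e is supported on K is a
-- case analysis on a non-face σ; the only case that needs admissibility is u, v ∈ σ with
-- σ - u ∈ K, where a missing face of K inside σ through u and v would have dimension at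
-- most dim K.

open import Defs
open import Algebra.Bundles using (CommutativeMonoid; CommutativeRing)
open import Data.Bool using (Bool; true; false; not; _∧_; _xor_; if_then_else_)
open import Data.Bool.Properties
  using (∨-zeroʳ; ∨-identityʳ; ∧-zeroʳ; ∧-conicalˡ; ∧-conicalʳ; ∧-distribˡ-xor; ¬-not;
         xor-same; xor-identityʳ; ∧-commutativeMonoid; xor-∧-commutativeRing)
open import Data.Fin using (Fin; zero; suc; _≟_; punchIn)
open import Data.Fin.Properties using (punchInᵢ≢i; any?)
open import Data.Fin.Subset using (Subset; _∈_; _∉_; _⊆_; ⁅_⁆; _∪_; _-_; ∣_∣)
open import Data.Fin.Subset.Properties
  using (x∈⁅x⁆; ∪-identityʳ; ∪-assoc; ∪-comm; p─⊥≡p; p─q⊆p; p⊆p∪q; q⊆p∪q; x∈p∪q⁻;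
         x∈p∧x≢y⇒x∈p-y; _∈?_; ⊆-trans; x∈p⇒∣p-x∣<∣p∣)
open import Data.List using (foldr; map; tabulate)
open import Data.List.Properties using (map-tabulate)
open import Data.Nat as ℕ using (ℕ; zero; suc)
open import Data.Nat.Induction using (<-wellFounded)
open import Data.Nat.Properties using (suc-injective; ≤-reflexive)
open import Data.Product using (∃; Σ; _×_; _,_; proj₁; proj₂)
open import Data.Sum using (_⊎_; inj₁; inj₂; [_,_]′)
open import Data.Vec using (Vec; _∷_; lookup; _[_]≔_)
open import Data.Vec.Functional using (removeAt)
open import Data.Vec.Properties
  using (lookup∘update; lookup∘update′; []≔-idempotent; []≔-commutes; []≔-lookup;
         []=⇒lookup; lookup⇒[]=)
open import Function using (_∘_; id)
open import Function.Bundles using (_⇔_; mk⇔; Equivalence)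
open import Induction.WellFounded using (Acc; acc)
open import Relation.Binary.Construct.Closure.ReflexiveTransitive using (ε; _◅_)
open import Relation.Binary.PropositionalEquality
open import Relation.Nullary using (¬_; Dec; yes; no; ¬?; _×-dec_; _⊎-dec_; contradiction)
open import Relation.Nullary.Decidable using (decidable-stable; map′; dec-true; dec-false; does)

open import Algebra.Properties.Semiring.Sum (CommutativeRing.semiring xor-∧-commutativeRing)
  using (sum; sum-cong-≗; sum-remove; sum-replicate-zero; ∑-distrib-+; *-distribˡ-sum)
open import Algebra.Properties.CommutativeSemigroup
  (CommutativeMonoid.commutativeSemigroup ∧-commutativeMonoid) using (x∙yz≈y∙xz)
open import Algebra.Properties.CommutativeSemigroup
  (CommutativeMonoid.commutativeSemigroup (CommutativeRing.+-commutativeMonoid xor-∧-commutativeRing))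
  using () renaming (interchange to xor-interchange)

private variable
  A : Set
  n : ℕ
  p q : Subset n
  x y : Fin n
  c d : Chain n
  P Q : Subset n → Set
  H K : FaceSet n

-- Subsets of Fin n

-- Inserting or removing a point is a vector update, so the set identities below reduce to the
-- update laws of Data.Vec.Properties.

∪⁅⁆≡[]≔ : ∀ (p : Subset n) x → p ∪ ⁅ x ⁆ ≡ p [ x ]≔ true
∪⁅⁆≡[]≔ (b ∷ p) zero    = cong₂ _∷_ (∨-zeroʳ b) (∪-identityʳ p)
∪⁅⁆≡[]≔ (b ∷ p) (suc x) = cong₂ _∷_ (∨-identityʳ b) (∪⁅⁆≡[]≔ p x)

-≡[]≔ : ∀ (p : Subset n) x → p - x ≡ p [ x ]≔ false
-≡[]≔ (b ∷ p) zero    = cong (false ∷_) (p─⊥≡p p)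
-≡[]≔ (b ∷ p) (suc x) = cong (b ∷_) (-≡[]≔ p x)

∪⁅⁆≡[]≔′ : p ≡ q → p ∪ ⁅ x ⁆ ≡ q [ x ]≔ true
∪⁅⁆≡[]≔′ {q = q} {x = x} refl = ∪⁅⁆≡[]≔ q x

-≡[]≔′ : p ≡ q → p - x ≡ q [ x ]≔ false
-≡[]≔′ {q = q} {x = x} refl = -≡[]≔ q x

lookup∘∪⁅⁆ : ∀ (p : Subset n) x → lookup (p ∪ ⁅ x ⁆) x ≡ true
lookup∘∪⁅⁆ p x = trans (cong (λ r → lookup r x) (∪⁅⁆≡[]≔ p x)) (lookup∘update x p true)

lookup∘∪⁅⁆′ : ∀ (p : Subset n) → y ≢ x → lookup (p ∪ ⁅ x ⁆) y ≡ lookup p y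
lookup∘∪⁅⁆′ {y = y} p y≢x = trans (cong (λ r → lookup r y) (∪⁅⁆≡[]≔ p _)) (lookup∘update′ y≢x p true)

lookup∘- : ∀ (p : Subset n) x → lookup (p - x) x ≡ false
lookup∘- p x = trans (cong (λ r → lookup r x) (-≡[]≔ p x)) (lookup∘update x p false)

lookup∘-′ : ∀ (p : Subset n) → y ≢ x → lookup (p - x) y ≡ lookup p y
lookup∘-′ {y = y} p y≢x = trans (cong (λ r → lookup r y) (-≡[]≔ p _)) (lookup∘update′ y≢x p false)

∉⇒lookup≡false : x ∉ p → lookup p x ≡ false
∉⇒lookup≡false {x = x} {p = p} x∉p = ¬-not (x∉p ∘ lookup⇒[]= x p)

lookup≡false⇒∉ : lookup p x ≡ false → x ∉ p
lookup≡false⇒∉ p[x]≡false x∈p with () ← trans (sym ([]=⇒lookup x∈p)) p[x]≡false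

x∈p-y⇒x≢y : ∀ (p : Subset n) → x ∈ p - y → x ≢ y
x∈p-y⇒x≢y {x = x} p x∈p-x refl with () ← trans (sym ([]=⇒lookup x∈p-x)) (lookup∘- p x)

lookup∘∪⁅⁆-true : ∀ (p : Subset n) y → lookup p x ≡ true → lookup (p ∪ ⁅ y ⁆) x ≡ true
lookup∘∪⁅⁆-true {x = x} p y p[x]≡true = []=⇒lookup (p⊆p∪q ⁅ y ⁆ (lookup⇒[]= x p p[x]≡true))

⊆-remove : p ⊆ q → x ∉ p → p ⊆ q - x
⊆-remove p⊆q x∉p y∈p = x∈p∧x≢y⇒x∈p-y (p⊆q y∈p) λ { refl → x∉p y∈p }

-⁺ : p ⊆ q → p - x ⊆ q - x
-⁺ {p = p} {x = x} p⊆q y∈p-x = x∈p∧x≢y⇒x∈p-y (p⊆q (p─q⊆p p ⁅ x ⁆ y∈p-x)) (x∈p-y⇒x≢y p y∈p-x)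

∪⁅⁆⁺ : p ⊆ q → p ∪ ⁅ x ⁆ ⊆ q ∪ ⁅ x ⁆
∪⁅⁆⁺ {p = p} {q = q} {x = x} p⊆q y∈p∪x =
  [ p⊆p∪q ⁅ x ⁆ ∘ p⊆q , q⊆p∪q q ⁅ x ⁆ ]′ (x∈p∪q⁻ p ⁅ x ⁆ y∈p∪x)

[]≔-self : ∀ (xs : Vec A n) {x} {a} → lookup xs x ≡ a → xs [ x ]≔ a ≡ xs
[]≔-self xs {x} refl = []≔-lookup xs x

[]≔-restore : ∀ (xs : Vec A n) {x y} {a a′ a″} → x ≢ y → lookup xs x ≡ a →
              ((xs [ x ]≔ a′) [ y ]≔ a″) [ x ]≔ a ≡ xs [ y ]≔ a″
[]≔-restore xs {x} {y} {a} {a′} {a″} x≢y xs[x]≡a = begin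
  ((xs [ x ]≔ a′) [ y ]≔ a″) [ x ]≔ a  ≡⟨ cong (_[ x ]≔ a) ([]≔-commutes xs x y x≢y) ⟩
  ((xs [ y ]≔ a″) [ x ]≔ a′) [ x ]≔ a  ≡⟨ []≔-idempotent (xs [ y ]≔ a″) x ⟩
  (xs [ y ]≔ a″) [ x ]≔ a              ≡⟨ []≔-self _ (trans (lookup∘update′ x≢y xs a″) xs[x]≡a) ⟩
  xs [ y ]≔ a″                         ∎
  where open ≡-Reasoning

p-x≡p : lookup p x ≡ false → p - x ≡ p
p-x≡p {p = p} {x = x} p[x]≡false = trans (-≡[]≔ p x) ([]≔-self p p[x]≡false)

p∪⁅x⁆-x≡p-x : ∀ (p : Subset n) x → (p ∪ ⁅ x ⁆) - x ≡ p - x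
p∪⁅x⁆-x≡p-x p x = trans (-≡[]≔′ (∪⁅⁆≡[]≔ p x)) (trans ([]≔-idempotent p x) (sym (-≡[]≔ p x)))

p∪⁅x⁆-x≡p : lookup p x ≡ false → (p ∪ ⁅ x ⁆) - x ≡ p
p∪⁅x⁆-x≡p {p = p} {x = x} p[x]≡false = trans (p∪⁅x⁆-x≡p-x p x) (p-x≡p p[x]≡false)

p-x∪⁅x⁆≡p : lookup p x ≡ true → (p - x) ∪ ⁅ x ⁆ ≡ p
p-x∪⁅x⁆≡p {p = p} {x = x} p[x]≡true =
  trans (∪⁅⁆≡[]≔′ (-≡[]≔ p x)) (trans ([]≔-idempotent p x) ([]≔-self p p[x]≡true))

p∪⁅x⁆-y≡p-y∪⁅x⁆ : x ≢ y → (p ∪ ⁅ x ⁆) - y ≡ (p - y) ∪ ⁅ x ⁆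
p∪⁅x⁆-y≡p-y∪⁅x⁆ {x = x} {y = y} {p = p} x≢y =
  trans (-≡[]≔′ (∪⁅⁆≡[]≔ p x)) (trans ([]≔-commutes p x y x≢y) (sym (∪⁅⁆≡[]≔′ (-≡[]≔ p y))))

p∪⁅x⁆∪⁅y⁆≡p∪⁅y⁆∪⁅x⁆ : ∀ (p : Subset n) x y → (p ∪ ⁅ x ⁆) ∪ ⁅ y ⁆ ≡ (p ∪ ⁅ y ⁆) ∪ ⁅ x ⁆
p∪⁅x⁆∪⁅y⁆≡p∪⁅y⁆∪⁅x⁆ p x y =
  trans (∪-assoc p _ _) (trans (cong (p ∪_) (∪-comm ⁅ x ⁆ ⁅ y ⁆)) (sym (∪-assoc p _ _)))

p-x-y∪⁅x⁆≡p-y : x ≢ y → lookup p x ≡ true → ((p - x) - y) ∪ ⁅ x ⁆ ≡ p - y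
p-x-y∪⁅x⁆≡p-y {x = x} {y = y} {p = p} x≢y p[x]≡true =
  trans (∪⁅⁆≡[]≔′ (-≡[]≔′ (-≡[]≔ p x))) (trans ([]≔-restore p x≢y p[x]≡true) (sym (-≡[]≔ p y)))

p∪⁅x⁆∪⁅y⁆-x≡p∪⁅y⁆ : x ≢ y → lookup p x ≡ false → ((p ∪ ⁅ x ⁆) ∪ ⁅ y ⁆) - x ≡ p ∪ ⁅ y ⁆
p∪⁅x⁆∪⁅y⁆-x≡p∪⁅y⁆ {x = x} {y = y} {p = p} x≢y p[x]≡false =
  trans (-≡[]≔′ (∪⁅⁆≡[]≔′ (∪⁅⁆≡[]≔ p x))) (trans ([]≔-restore p x≢y p[x]≡false) (sym (∪⁅⁆≡[]≔ p y)))

∣p[x]≔true∣ : ∀ (p : Subset n) x → lookup p x ≡ false → ∣ p [ x ]≔ true ∣ ≡ suc ∣ p ∣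
∣p[x]≔true∣ (false ∷ p) zero    refl     = refl
∣p[x]≔true∣ (true  ∷ p) (suc x) p[x]≡false = cong suc (∣p[x]≔true∣ p x p[x]≡false)
∣p[x]≔true∣ (false ∷ p) (suc x) p[x]≡false = ∣p[x]≔true∣ p x p[x]≡false

∣p∪⁅x⁆∣≡1+∣p∣ : ∀ (p : Subset n) x → lookup p x ≡ false → ∣ p ∪ ⁅ x ⁆ ∣ ≡ suc ∣ p ∣
∣p∪⁅x⁆∣≡1+∣p∣ p x p[x]≡false = trans (cong ∣_∣ (∪⁅⁆≡[]≔ p x)) (∣p[x]≔true∣ p x p[x]≡false)

∣p∣≡1+∣p-x∣ : ∀ (p : Subset n) x → lookup p x ≡ true → ∣ p ∣ ≡ suc ∣ p - x ∣
∣p∣≡1+∣p-x∣ p x p[x]≡true =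
  trans (cong ∣_∣ (sym (p-x∪⁅x⁆≡p {p = p} {x = x} p[x]≡true))) (∣p∪⁅x⁆∣≡1+∣p∣ (p - x) x (lookup∘- p x))

-- The boundary operator over ℤ₂

sum≡true⇒∃ : ∀ (t : Fin n → Bool) → sum t ≡ true → ∃ λ i → t i ≡ true
sum≡true⇒∃ {suc n} t ∑t≡true with t zero in t₀
... | true  = zero , t₀
... | false = let i , tᵢ = sum≡true⇒∃ (t ∘ suc) ∑t≡true in suc i , tᵢ

sum-symmetric-zeroDiagonal : ∀ (a : Fin n → Fin n → Bool) →
  (∀ i j → a i j ≡ a j i) → (∀ i → a i i ≡ false) → sum (λ i → sum (a i)) ≡ false
sum-symmetric-zeroDiagonal {zero}  a symm diag = refl
sum-symmetric-zeroDiagonal {suc n} a symm diag = begin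
  (a zero zero xor r) xor sum (λ i → a (suc i) zero xor sum (a (suc i) ∘ suc))
    ≡⟨ cong₂ (λ x y → (x xor r) xor y) (diag zero) (∑-distrib-+ (λ i → a (suc i) zero) _) ⟩
  r xor (sum (λ i → a (suc i) zero) xor sum (λ i → sum (a (suc i) ∘ suc)))
    ≡⟨ cong₂ (λ x y → r xor (x xor y)) (sum-cong-≗ (λ i → symm (suc i) zero))
         (sum-symmetric-zeroDiagonal (λ i j → a (suc i) (suc j)) (λ i j → symm (suc i) (suc j))
                                     (diag ∘ suc)) ⟩
  r xor (r xor false)  ≡⟨ cong (r xor_) (xor-identityʳ r) ⟩
  r xor r              ≡⟨ xor-same r ⟩
  false                ∎
  where
  open ≡-Reasoning
  r = sum (a zero ∘ suc)

∂-term : Chain n → Subset n → Fin n → Bool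
∂-term c σ i = not (lookup σ i) ∧ c (σ ∪ ⁅ i ⁆)

∂-sum : ∀ (c : Chain n) σ → ∂ c σ ≡ sum (∂-term c σ)
∂-sum {n} c σ = begin
  foldr _xor_ false (map t (tabulate id))  ≡⟨ cong (foldr _xor_ false) (map-tabulate id t) ⟩
  foldr _xor_ false (tabulate t)           ≡⟨ foldr-tabulate t ⟩
  sum t                                    ≡⟨ sum-cong-≗ (λ i → if-false (lookup σ i)) ⟩
  sum (∂-term c σ)                         ∎
  where
  open ≡-Reasoning
  t : Fin n → Bool
  t i = if lookup σ i then false else c (σ ∪ ⁅ i ⁆)
  foldr-tabulate : ∀ {m} (s : Fin m → Bool) → foldr _xor_ false (tabulate s) ≡ sum s
  foldr-tabulate {zero}  s = refl
  foldr-tabulate {suc m} s = cong (s zero xor_) (foldr-tabulate (s ∘ suc))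
  if-false : ∀ b {x} → (if b then false else x) ≡ not b ∧ x
  if-false true  = refl
  if-false false = refl

∂-cong : c ≈ d → ∂ c ≈ ∂ d
∂-cong {c = c} {d = d} c≈d σ =
  trans (∂-sum c σ) (trans (sum-cong-≗ (λ i → cong (not (lookup σ i) ∧_) (c≈d _))) (sym (∂-sum d σ)))

∂-⊕ : ∀ (c d : Chain n) → ∂ (c ⊕ d) ≈ (∂ c ⊕ ∂ d)
∂-⊕ c d σ = begin
  ∂ (c ⊕ d) σ                                ≡⟨ ∂-sum (c ⊕ d) σ ⟩
  sum (∂-term (c ⊕ d) σ)                     ≡⟨ sum-cong-≗ (λ i → ∧-distribˡ-xor (not (lookup σ i)) _ _) ⟩
  sum (λ i → ∂-term c σ i xor ∂-term d σ i)  ≡⟨ ∑-distrib-+ (∂-term c σ) (∂-term d σ) ⟩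
  sum (∂-term c σ) xor sum (∂-term d σ)      ≡⟨ cong₂ _xor_ (∂-sum c σ) (∂-sum d σ) ⟨
  ∂ c σ xor ∂ d σ                            ∎
  where open ≡-Reasoning

∂-vanishes : ∀ (c : Chain n) σ → (∀ i → lookup σ i ≡ false → c (σ ∪ ⁅ i ⁆) ≡ false) → ∂ c σ ≡ false
∂-vanishes {n} c σ cofaces≡false =
  trans (∂-sum c σ) (trans (sum-cong-≗ term≡false) (sum-replicate-zero n))
  where
  term≡false : ∀ i → ∂-term c σ i ≡ false
  term≡false i with lookup σ i in σ[i]
  ... | true  = refl
  ... | false = cofaces≡false i σ[i]

∂-single : ∀ (c : Chain n) σ {w} → lookup σ w ≡ false →
           (∀ i → i ≢ w → c (σ ∪ ⁅ i ⁆) ≡ false) → ∂ c σ ≡ c (σ ∪ ⁅ w ⁆)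
∂-single {suc n} c σ {w} σ[w]≡false others≡false = begin
  ∂ c σ                                           ≡⟨ ∂-sum c σ ⟩
  sum (∂-term c σ)                                ≡⟨ sum-remove {i = w} (∂-term c σ) ⟩
  ∂-term c σ w xor sum (removeAt (∂-term c σ) w)
    ≡⟨ cong₂ _xor_ (cong (λ b → not b ∧ c (σ ∪ ⁅ w ⁆)) σ[w]≡false) rest≡false ⟩
  c (σ ∪ ⁅ w ⁆) xor false                         ≡⟨ xor-identityʳ _ ⟩
  c (σ ∪ ⁅ w ⁆)                                   ∎
  where
  open ≡-Reasoning
  rest≡false : sum (removeAt (∂-term c σ) w) ≡ false
  rest≡false = trans
    (sum-cong-≗ (λ j → trans (cong (not (lookup σ (punchIn w j)) ∧_) (others≡false _ (punchInᵢ≢i w j)))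
                              (∧-zeroʳ _)))
    (sum-replicate-zero n)

∂-∂ : ∀ (c : Chain n) σ → ∂ (∂ c) σ ≡ false
∂-∂ {n} c σ = begin
  ∂ (∂ c) σ
    ≡⟨ ∂-sum (∂ c) σ ⟩
  sum (λ i → not (lookup σ i) ∧ ∂ c (σ ∪ ⁅ i ⁆))
    ≡⟨ sum-cong-≗ (λ i → cong (not (lookup σ i) ∧_) (∂-sum c (σ ∪ ⁅ i ⁆))) ⟩
  sum (λ i → not (lookup σ i) ∧ sum (∂-term c (σ ∪ ⁅ i ⁆)))
    ≡⟨ sum-cong-≗ (λ i → *-distribˡ-sum (not (lookup σ i)) (∂-term c (σ ∪ ⁅ i ⁆))) ⟩
  sum (λ i → sum (a i))
    ≡⟨ sum-symmetric-zeroDiagonal a a-symmetric a-diagonal ⟩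
  false
    ∎
  where
  open ≡-Reasoning
  a : Fin n → Fin n → Bool
  a i j = not (lookup σ i) ∧ ∂-term c (σ ∪ ⁅ i ⁆) j
  a-diagonal : ∀ i → a i i ≡ false
  a-diagonal i = trans (cong (λ b → not (lookup σ i) ∧ (not b ∧ c ((σ ∪ ⁅ i ⁆) ∪ ⁅ i ⁆))) (lookup∘∪⁅⁆ σ i))
                       (∧-zeroʳ _)
  a-symmetric : ∀ i j → a i j ≡ a j i
  a-symmetric i j with i ≟ j
  ... | yes refl = refl
  ... | no i≢j = begin
    not (lookup σ i) ∧ (not (lookup (σ ∪ ⁅ i ⁆) j) ∧ c ((σ ∪ ⁅ i ⁆) ∪ ⁅ j ⁆))
      ≡⟨ cong₂ (λ b τ → not (lookup σ i) ∧ (not b ∧ c τ))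
               (lookup∘∪⁅⁆′ σ (i≢j ∘ sym)) (p∪⁅x⁆∪⁅y⁆≡p∪⁅y⁆∪⁅x⁆ σ i j) ⟩
    not (lookup σ i) ∧ (not (lookup σ j) ∧ c ((σ ∪ ⁅ j ⁆) ∪ ⁅ i ⁆))
      ≡⟨ x∙yz≈y∙xz (not (lookup σ i)) (not (lookup σ j)) _ ⟩
    not (lookup σ j) ∧ (not (lookup σ i) ∧ c ((σ ∪ ⁅ j ⁆) ∪ ⁅ i ⁆))
      ≡⟨ cong (λ b → not (lookup σ j) ∧ (not b ∧ c ((σ ∪ ⁅ j ⁆) ∪ ⁅ i ⁆))) (sym (lookup∘∪⁅⁆′ σ i≢j)) ⟩
    not (lookup σ j) ∧ (not (lookup (σ ∪ ⁅ j ⁆) i) ∧ c ((σ ∪ ⁅ j ⁆) ∪ ⁅ i ⁆))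
      ∎

-- Chain maps

Supported : (Subset n → Set) → Chain n → Set
Supported P c = ∀ σ → c σ ≡ true → P σ

⊕-supported : Supported P c → Supported P d → Supported P (c ⊕ d)
⊕-supported {c = c} c⊆P d⊆P σ with c σ in c[σ]
... | true  = λ _ → c⊆P σ c[σ]
... | false = d⊆P σ

∂-supported : (∀ {σ i} → lookup σ i ≡ false → P (σ ∪ ⁅ i ⁆) → Q σ) → Supported P c → Supported Q (∂ c)
∂-supported {c = c} coface⇒ c⊆P σ ∂c[σ]≡true
  with i , term≡true ← sum≡true⇒∃ (∂-term c σ) (trans (sym (∂-sum c σ)) ∂c[σ]≡true)
  with lookup σ i in σ[i]
... | false = coface⇒ σ[i] (c⊆P _ term≡true)

outside-support : Supported P c → ∀ σ → ¬ P σ → c σ ≡ false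
outside-support {c = c} c⊆P σ ¬Pσ with c σ in c[σ]
... | false = refl
... | true  = contradiction (c⊆P σ c[σ]) ¬Pσ

chain-faces : ∀ {k} → IsChain K k c → Supported K c
chain-faces c∈ σ = proj₁ ∘ c∈ σ

chain-sizes : ∀ {k} → IsChain K k c → Supported (λ σ → ∣ σ ∣ ≡ suc k) c
chain-sizes c∈ σ = proj₂ ∘ c∈ σ

∂-lowers-size : ∀ {m} → Supported (λ σ → ∣ σ ∣ ≡ suc m) c → Supported (λ σ → ∣ σ ∣ ≡ m) (∂ c)
∂-lowers-size = ∂-supported λ {σ} {i} σ[i]≡false ∣σ∪i∣≡1+m →
  suc-injective (trans (sym (∣p∪⁅x⁆∣≡1+∣p∣ σ i σ[i]≡false)) ∣σ∪i∣≡1+m)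

∂-isChain : IsComplex H → ∀ k → IsChain H (suc k) c → IsChain H k (∂ c)
∂-isChain cH k c∈ σ ∂c[σ] =
  ∂-supported (λ {σ} {i} _ → IsComplex.downClosed cH (p⊆p∪q ⁅ i ⁆)) (chain-faces c∈) σ ∂c[σ] ,
  ∂-lowers-size (chain-sizes c∈) σ ∂c[σ]

inclusion : (∀ σ → H σ → K σ) → Σ (ChainMap H K) Injective
inclusion H⊆K = record
  { f         = λ _ c → c
  ; f-cong    = λ _ _ _ _ _ c≈d → c≈d
  ; f-into    = λ _ c c∈C[H] σ c[σ] → let Hσ , ∣σ∣ = c∈C[H] σ c[σ] in H⊆K σ Hσ , ∣σ∣
  ; f-linear  = λ _ _ _ _ _ _ → refl
  ; f-commute = λ _ _ _ _ → refl
  } , λ _ _ _ _ _ c≈d → c≈d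

compose : ∀ {K₁} → IsComplex H → IsComplex K₁ →
          Σ (ChainMap H K₁) Injective → Σ (ChainMap K₁ K) Injective → Σ (ChainMap H K) Injective
compose cH cK₁ (φ , φ-injective) (ψ , ψ-injective) = record
  { f         = λ k c → Ψ.f k (Φ.f k c)
  ; f-cong    = λ k c d c∈ d∈ c≈d →
      Ψ.f-cong k _ _ (Φ.f-into k c c∈) (Φ.f-into k d d∈) (Φ.f-cong k c d c∈ d∈ c≈d)
  ; f-into    = λ k c c∈ → Ψ.f-into k _ (Φ.f-into k c c∈)
  ; f-linear  = λ k c d c∈ d∈ σ → trans
      (Ψ.f-cong k _ _ (Φ.f-into k _ (⊕-supported c∈ d∈)) (⊕-supported (Φ.f-into k c c∈) (Φ.f-into k d d∈))
                (Φ.f-linear k c d c∈ d∈) σ)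
      (Ψ.f-linear k _ _ (Φ.f-into k c c∈) (Φ.f-into k d d∈) σ)
  ; f-commute = λ k c c∈ σ → trans
      (Ψ.f-cong k _ _ (Φ.f-into k _ (∂-isChain cH k c∈)) (∂-isChain cK₁ k (Φ.f-into (suc k) c c∈))
                (Φ.f-commute k c c∈) σ)
      (Ψ.f-commute k _ (Φ.f-into (suc k) c c∈) σ)
  } , λ k c d c∈ d∈ ψφc≈ψφd →
        φ-injective k c d c∈ d∈ (ψ-injective k _ _ (Φ.f-into k c c∈) (Φ.f-into k d d∈) ψφc≈ψφd)
  where
  module Φ = ChainMap φ
  module Ψ = ChainMap ψ

module Perturbation (h : Chain n → Chain n) (h-cong : ∀ {c d} → c ≈ d → h c ≈ h d)
                    (h-⊕ : ∀ c d → h (c ⊕ d) ≈ (h c ⊕ h d)) where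

  perturb : Chain n → Chain n
  perturb e = e ⊕ (∂ (h e) ⊕ h (∂ e))

  h-zero : c ≈ (λ _ → false) → h c ≈ (λ _ → false)
  h-zero {c = c} c≈0 σ = begin
    h c σ                ≡⟨ h-cong (λ τ → trans (c≈0 τ) (sym (xor-same (c τ)))) σ ⟩
    h (c ⊕ c) σ          ≡⟨ h-⊕ c c σ ⟩
    h c σ xor h c σ      ≡⟨ xor-same (h c σ) ⟩
    false                ∎
    where open ≡-Reasoning

  perturb-cong : c ≈ d → perturb c ≈ perturb d
  perturb-cong c≈d σ = cong₂ _xor_ (c≈d σ) (cong₂ _xor_ (∂-cong (h-cong c≈d) σ) (h-cong (∂-cong c≈d) σ))

  perturb-⊕ : ∀ c d → perturb (c ⊕ d) ≈ (perturb c ⊕ perturb d)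
  perturb-⊕ c d σ = begin
    (c σ xor d σ) xor (∂ (h (c ⊕ d)) σ xor h (∂ (c ⊕ d)) σ)
      ≡⟨ cong ((c σ xor d σ) xor_) (cong₂ _xor_ (trans (∂-cong (h-⊕ c d) σ) (∂-⊕ (h c) (h d) σ))
                                                (trans (h-cong (∂-⊕ c d) σ) (h-⊕ (∂ c) (∂ d) σ))) ⟩
    (c σ xor d σ) xor ((∂ (h c) σ xor ∂ (h d) σ) xor (h (∂ c) σ xor h (∂ d) σ))
      ≡⟨ cong ((c σ xor d σ) xor_) (xor-interchange (∂ (h c) σ) (∂ (h d) σ) (h (∂ c) σ) (h (∂ d) σ)) ⟩
    (c σ xor d σ) xor ((∂ (h c) σ xor h (∂ c) σ) xor (∂ (h d) σ xor h (∂ d) σ))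
      ≡⟨ xor-interchange (c σ) (d σ) (∂ (h c) σ xor h (∂ c) σ) (∂ (h d) σ xor h (∂ d) σ) ⟩
    perturb c σ xor perturb d σ
      ∎
    where open ≡-Reasoning

  perturb-∂ : ∀ c → perturb (∂ c) ≈ ∂ (perturb c)
  perturb-∂ c σ = begin
    ∂ c σ xor (∂ (h (∂ c)) σ xor h (∂ (∂ c)) σ)
      ≡⟨ cong (λ b → ∂ c σ xor (∂ (h (∂ c)) σ xor b)) (h-zero (∂-∂ c) σ) ⟩
    ∂ c σ xor (∂ (h (∂ c)) σ xor false)
      ≡⟨ cong (∂ c σ xor_) (xor-identityʳ _) ⟩
    ∂ c σ xor ∂ (h (∂ c)) σ
      ≡⟨ cong (λ b → ∂ c σ xor (b xor ∂ (h (∂ c)) σ)) (∂-∂ (h c) σ) ⟨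
    ∂ c σ xor (∂ (∂ (h c)) σ xor ∂ (h (∂ c)) σ)
      ≡⟨ cong (∂ c σ xor_) (∂-⊕ (∂ (h c)) (h (∂ c)) σ) ⟨
    ∂ c σ xor ∂ (∂ (h c) ⊕ h (∂ c)) σ
      ≡⟨ ∂-⊕ c (∂ (h c) ⊕ h (∂ c)) σ ⟨
    ∂ (perturb c) σ
      ∎
    where open ≡-Reasoning

-- Missing faces and admissibility

missingFace⊆ : IsComplex K → ∀ σ → ¬ K σ → ∃ λ M → M ⊆ σ × MissingFace K M
missingFace⊆ {K = K} cK σ = go σ (<-wellFounded ∣ σ ∣)
  where
  open IsComplex cK
  go : ∀ σ → Acc ℕ._<_ ∣ σ ∣ → ¬ K σ → ∃ λ M → M ⊆ σ × MissingFace K M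
  go σ (acc smaller) σ∉K with any? (λ x → x ∈? σ ×-dec ¬? (decide (σ - x)))
  ... | yes (x , x∈σ , σ-x∉K) =
    let M , M⊆σ-x , M-missing = go (σ - x) (smaller (x∈p⇒∣p-x∣<∣p∣ x∈σ)) σ-x∉K
    in  M , ⊆-trans M⊆σ-x (p─q⊆p σ ⁅ x ⁆) , M-missing
  ... | no ∄x = σ , id , σ∉K , λ S (S⊆σ , x , x∈σ , x∉S) →
    downClosed (⊆-remove S⊆σ x∉S) (decidable-stable (decide (σ - x)) λ σ-x∉K → ∄x (x , x∈σ , σ-x∉K))

admissible-face : IsComplex K → Admissible K x y → ∀ {σ i} → x ∈ σ → y ∈ σ → i ∉ σ →
                  K (σ - x) → K ((σ - y) ∪ ⁅ i ⁆) → K σ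
admissible-face {K = K} {x = x} {y = y} cK (_ , _ , _ , no-missing-xy) {σ} {i} x∈σ y∈σ i∉σ Kσ-x Kσ-y∪i =
  decidable-stable (decide σ) ¬¬Kσ
  where
  open IsComplex cK
  ¬¬Kσ : ¬ ¬ K σ
  ¬¬Kσ σ∉K with M , M⊆σ , M∉K , M-minimal ← missingFace⊆ cK σ σ∉K =
    no-missing-xy M (M∉K , M-minimal) (W , downClosed W⊆σ-y∪i Kσ-y∪i , ≤-reflexive ∣M∣≡∣W∣) (x∈M , y∈M)
    where
    x∈M : x ∈ M
    x∈M = decidable-stable (x ∈? M) λ x∉M → M∉K (downClosed (⊆-remove M⊆σ x∉M) Kσ-x)
    y∈M : y ∈ M
    y∈M = decidable-stable (y ∈? M) λ y∉M →
      M∉K (downClosed (⊆-trans (⊆-remove M⊆σ y∉M) (p⊆p∪q ⁅ i ⁆)) Kσ-y∪i)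
    W = (M - y) ∪ ⁅ i ⁆
    W⊆σ-y∪i : W ⊆ (σ - y) ∪ ⁅ i ⁆
    W⊆σ-y∪i = ∪⁅⁆⁺ (-⁺ M⊆σ)
    ∣M∣≡∣W∣ : ∣ M ∣ ≡ ∣ W ∣
    ∣M∣≡∣W∣ = trans (∣p∣≡1+∣p-x∣ M y ([]=⇒lookup y∈M))
                    (sym (∣p∪⁅x⁆∣≡1+∣p∣ (M - y) i (∉⇒lookup≡false (i∉σ ∘ M⊆σ ∘ p─q⊆p M ⁅ y ⁆))))

-- Contractions

isComplex-⇔ : (∀ T → H T ⇔ K T) → IsComplex K → IsComplex H
isComplex-⇔ H⇔K cK = record
  { decide     = λ T → map′ (from (H⇔K T)) (to (H⇔K T)) (decide T)
  ; downClosed = λ {T} {τ} τ⊆T → from (H⇔K τ) ∘ downClosed τ⊆T ∘ to (H⇔K T)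
  }
  where open IsComplex cK; open Equivalence

module _ {K : FaceSet n} (cK : IsComplex K) {u v : Fin n} (u≢v : u ≢ v) where
  open IsComplex cK

  -- (T - v) ∪ ⁅ u ⁆ is the face of K that contracts onto T.
  contraction⇔ : ∀ T → Contraction K u v T ⇔ (u ∉ T × (K T ⊎ (v ∈ T × K ((T - v) ∪ ⁅ u ⁆))))
  contraction⇔ T = mk⇔ to from
    where
    to : Contraction K u v T → u ∉ T × (K T ⊎ (v ∈ T × K ((T - v) ∪ ⁅ u ⁆)))
    to (inj₁ (u∉T , KT))            = u∉T , inj₁ KT
    to (inj₂ (S , u∈S , KS , refl)) =
      lookup≡false⇒∉ (trans (lookup∘∪⁅⁆′ (S - u) u≢v) (lookup∘- S u)) ,
      inj₂ (q⊆p∪q (S - u) ⁅ v ⁆ (x∈⁅x⁆ v) , downClosed (subst (_⊆ S) (sym lift≡S-v) (p─q⊆p S ⁅ v ⁆)) KS)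
      where
      lift≡S-v : ((((S - u) ∪ ⁅ v ⁆) - v) ∪ ⁅ u ⁆) ≡ S - v
      lift≡S-v = trans (cong (_∪ ⁅ u ⁆) (p∪⁅x⁆-x≡p-x (S - u) v)) (p-x-y∪⁅x⁆≡p-y u≢v ([]=⇒lookup u∈S))
    from : u ∉ T × (K T ⊎ (v ∈ T × K ((T - v) ∪ ⁅ u ⁆))) → Contraction K u v T
    from (u∉T , inj₁ KT)            = inj₁ (u∉T , KT)
    from (u∉T , inj₂ (v∈T , Klift)) = inj₂ (_ , q⊆p∪q (T - v) ⁅ u ⁆ (x∈⁅x⁆ u) , Klift , sym contract-lift≡T)
      where
      contract-lift≡T : ((((T - v) ∪ ⁅ u ⁆) - u) ∪ ⁅ v ⁆) ≡ T
      contract-lift≡T = trans (cong (_∪ ⁅ v ⁆) (p∪⁅x⁆-x≡p (trans (lookup∘-′ T u≢v) (∉⇒lookup≡false u∉T))))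
                              (p-x∪⁅x⁆≡p ([]=⇒lookup v∈T))

  contraction-avoids : ∀ {T} → Contraction K u v T → u ∉ T
  contraction-avoids {T} = proj₁ ∘ Equivalence.to (contraction⇔ T)

  contraction-∉K : ∀ {T} → Contraction K u v T → ¬ K T → v ∈ T × K ((T - v) ∪ ⁅ u ⁆)
  contraction-∉K {T} T∈K′ T∉K with Equivalence.to (contraction⇔ T) T∈K′
  ... | _ , inj₁ KT  = contradiction KT T∉K
  ... | _ , inj₂ lift∈K = lift∈K

  contraction-isComplex : IsComplex (Contraction K u v)
  contraction-isComplex = record
    { decide     = λ T → map′ (from (contraction⇔ T)) (to (contraction⇔ T))
                      (¬? (u ∈? T) ×-dec (decide T ⊎-dec (v ∈? T ×-dec decide ((T - v) ∪ ⁅ u ⁆))))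
    ; downClosed = downClosed′
    }
    where
    open Equivalence
    downClosed′ : ∀ {T τ} → τ ⊆ T → Contraction K u v T → Contraction K u v τ
    downClosed′ {T} {τ} τ⊆T T∈K′ with to (contraction⇔ T) T∈K′
    ... | u∉T , inj₁ KT = inj₁ (u∉T ∘ τ⊆T , downClosed τ⊆T KT)
    ... | u∉T , inj₂ (v∈T , Klift) with v ∈? τ
    ...   | yes v∈τ = from (contraction⇔ τ) (u∉T ∘ τ⊆T , inj₂ (v∈τ , downClosed (∪⁅⁆⁺ (-⁺ τ⊆T)) Klift))
    ...   | no  v∉τ = inj₁ (u∉T ∘ τ⊆T , downClosed (⊆-trans (⊆-remove τ⊆T v∉τ) (p⊆p∪q ⁅ u ⁆)) Klift)

module ContractionChainMap {K : FaceSet n} (cK : IsComplex K) {u v : Fin n} (adm : Admissible K u v) where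
  open IsComplex cK

  private
    u≢v : u ≢ v
    u≢v = proj₁ (proj₂ (proj₂ adm))

  outsideK : Chain n → Chain n
  outsideK c τ = not (does (decide τ)) ∧ c τ

  h : Chain n → Chain n
  h c σ = (lookup σ u ∧ lookup σ v) ∧ outsideK c (σ - u)

  h-cong : c ≈ d → h c ≈ h d
  h-cong c≈d σ = cong (λ b → (lookup σ u ∧ lookup σ v) ∧ (not (does (decide (σ - u))) ∧ b)) (c≈d (σ - u))

  h-⊕ : ∀ c d → h (c ⊕ d) ≈ (h c ⊕ h d)
  h-⊕ c d σ = trans (cong (_ ∧_) (∧-distribˡ-xor (not (does (decide (σ - u)))) _ _))
                    (∧-distribˡ-xor (lookup σ u ∧ lookup σ v) _ _)

  open Perturbation h h-cong h-⊕

  outsideK-∈K : ∀ c {τ} → K τ → outsideK c τ ≡ false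
  outsideK-∈K c {τ} Kτ = cong (λ b → not b ∧ c τ) (dec-true (decide τ) Kτ)

  outsideK-∉K : ∀ c {τ} → ¬ K τ → outsideK c τ ≡ c τ
  outsideK-∉K c {τ} τ∉K = cong (λ b → not b ∧ c τ) (dec-false (decide τ) τ∉K)

  h-off-u : ∀ c σ → lookup σ u ≡ false → h c σ ≡ false
  h-off-u c σ σ[u] = cong (λ b → (b ∧ lookup σ v) ∧ outsideK c (σ - u)) σ[u]

  h-off-v : ∀ c σ → lookup σ v ≡ false → h c σ ≡ false
  h-off-v c σ σ[v] =
    cong (_∧ outsideK c (σ - u)) (trans (cong (lookup σ u ∧_) σ[v]) (∧-zeroʳ (lookup σ u)))

  h-cone : ∀ c σ → lookup σ u ≡ true → lookup σ v ≡ true → h c σ ≡ outsideK c (σ - u)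
  h-cone c σ σ[u] σ[v] = cong₂ (λ a b → (a ∧ b) ∧ outsideK c (σ - u)) σ[u] σ[v]

  h-raises-size : ∀ {m} → Supported (λ σ → ∣ σ ∣ ≡ m) c → Supported (λ σ → ∣ σ ∣ ≡ suc m) (h c)
  h-raises-size {c = c} c-size σ hc[σ] = trans (∣p∣≡1+∣p-x∣ σ u σ[u]) (cong suc (c-size (σ - u) c[σ-u]))
    where
    σ[u] : lookup σ u ≡ true
    σ[u] = ∧-conicalˡ _ _ (∧-conicalˡ (lookup σ u ∧ lookup σ v) _ hc[σ])
    c[σ-u] : c (σ - u) ≡ true
    c[σ-u] = ∧-conicalʳ _ _ (∧-conicalʳ (lookup σ u ∧ lookup σ v) _ hc[σ])

  perturb-size : ∀ {m} → Supported (λ σ → ∣ σ ∣ ≡ suc m) c → Supported (λ σ → ∣ σ ∣ ≡ suc m) (perturb c)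
  perturb-size c-size = ⊕-supported c-size
    (⊕-supported (∂-lowers-size (h-raises-size c-size)) (h-raises-size (∂-lowers-size c-size)))

  module _ {e : Chain n} (e⊆K′ : Supported (Contraction K u v) e) where

    e-on-u : ∀ {σ} → lookup σ u ≡ true → e σ ≡ false
    e-on-u {σ} σ[u] = outside-support e⊆K′ σ λ σ∈K′ →
      contraction-avoids cK u≢v σ∈K′ (lookup⇒[]= u σ σ[u])

    outsideK-vanishes : ∀ {τ} → ¬ (v ∈ τ × K ((τ - v) ∪ ⁅ u ⁆)) → outsideK e τ ≡ false
    outsideK-vanishes {τ} ¬lift∈K with decide τ
    ... | yes _  = refl
    ... | no τ∉K = outside-support e⊆K′ τ λ τ∈K′ → ¬lift∈K (contraction-∉K cK u≢v τ∈K′ τ∉K)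

    outsideK-off-v : ∀ {τ} → lookup τ v ≡ false → outsideK e τ ≡ false
    outsideK-off-v τ[v] = outsideK-vanishes λ (v∈τ , _) → lookup≡false⇒∉ τ[v] v∈τ

    perturb-off-u : ∀ {σ} → lookup σ u ≡ false → perturb e σ ≡ e σ xor outsideK e σ
    perturb-off-u {σ} σ[u] = begin
      e σ xor (∂ (h e) σ xor h (∂ e) σ)
        ≡⟨ cong₂ (λ a b → e σ xor (a xor b)) ∂he[σ] (h-off-u (∂ e) σ σ[u]) ⟩
      e σ xor (outsideK e σ xor false)
        ≡⟨ cong (e σ xor_) (xor-identityʳ _) ⟩
      e σ xor outsideK e σ
        ∎
      where
      open ≡-Reasoning
      v∧outsideK : lookup σ v ∧ outsideK e σ ≡ outsideK e σ
      v∧outsideK with lookup σ v in σ[v]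
      ... | true  = refl
      ... | false = sym (outsideK-off-v σ[v])
      ∂he[σ] : ∂ (h e) σ ≡ outsideK e σ
      ∂he[σ] = begin
        ∂ (h e) σ
          ≡⟨ ∂-single (h e) σ σ[u] (λ i i≢u →
               h-off-u e (σ ∪ ⁅ i ⁆) (trans (lookup∘∪⁅⁆′ σ (i≢u ∘ sym)) σ[u])) ⟩
        h e (σ ∪ ⁅ u ⁆)
          ≡⟨ cong₂ (λ a b → (a ∧ b) ∧ outsideK e ((σ ∪ ⁅ u ⁆) - u))
                   (lookup∘∪⁅⁆ σ u) (lookup∘∪⁅⁆′ σ (u≢v ∘ sym)) ⟩
        lookup σ v ∧ outsideK e ((σ ∪ ⁅ u ⁆) - u)
          ≡⟨ cong (λ τ → lookup σ v ∧ outsideK e τ) (p∪⁅x⁆-x≡p σ[u]) ⟩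
        lookup σ v ∧ outsideK e σ
          ≡⟨ v∧outsideK ⟩
        outsideK e σ
          ∎

    perturb-on-u : ∀ {σ} → lookup σ u ≡ true → perturb e σ ≡ ∂ (h e) σ xor h (∂ e) σ
    perturb-on-u {σ} σ[u] = cong (_xor (∂ (h e) σ xor h (∂ e) σ)) (e-on-u σ[u])

    perturb-on-u-off-v : ∀ {σ} → lookup σ u ≡ true → lookup σ v ≡ false →
                         perturb e σ ≡ outsideK e ((σ ∪ ⁅ v ⁆) - u)
    perturb-on-u-off-v {σ} σ[u] σ[v] = begin
      perturb e σ
        ≡⟨ perturb-on-u σ[u] ⟩
      ∂ (h e) σ xor h (∂ e) σ
        ≡⟨ cong₂ _xor_ (∂-single (h e) σ σ[v] λ i i≢v →
                          h-off-v e (σ ∪ ⁅ i ⁆) (trans (lookup∘∪⁅⁆′ σ (i≢v ∘ sym)) σ[v]))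
                       (h-off-v (∂ e) σ σ[v]) ⟩
      h e (σ ∪ ⁅ v ⁆) xor false
        ≡⟨ xor-identityʳ _ ⟩
      h e (σ ∪ ⁅ v ⁆)
        ≡⟨ h-cone e (σ ∪ ⁅ v ⁆) (lookup∘∪⁅⁆-true σ v σ[u]) (lookup∘∪⁅⁆ σ v) ⟩
      outsideK e ((σ ∪ ⁅ v ⁆) - u)
        ∎
      where open ≡-Reasoning

    ∂h≡∂[σ-u] : ∀ {σ} → lookup σ u ≡ true → lookup σ v ≡ true → ¬ K (σ - u) → ∂ (h e) σ ≡ ∂ e (σ - u)
    ∂h≡∂[σ-u] {σ} σ[u] σ[v] σ-u∉K = begin
      ∂ (h e) σ               ≡⟨ ∂-sum (h e) σ ⟩
      sum (∂-term (h e) σ)    ≡⟨ sum-cong-≗ term ⟩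
      sum (∂-term e (σ - u))  ≡⟨ ∂-sum e (σ - u) ⟨
      ∂ e (σ - u)             ∎
      where
      open ≡-Reasoning
      term-u : ∂-term (h e) σ u ≡ ∂-term e (σ - u) u
      term-u = begin
        not (lookup σ u) ∧ h e (σ ∪ ⁅ u ⁆)
          ≡⟨ cong (λ b → not b ∧ h e (σ ∪ ⁅ u ⁆)) σ[u] ⟩
        false
          ≡⟨ e-on-u σ[u] ⟨
        e σ
          ≡⟨ cong e (p-x∪⁅x⁆≡p σ[u]) ⟨
        e ((σ - u) ∪ ⁅ u ⁆)
          ≡⟨ cong (λ b → not b ∧ e ((σ - u) ∪ ⁅ u ⁆)) (lookup∘- σ u) ⟨
        not (lookup (σ - u) u) ∧ e ((σ - u) ∪ ⁅ u ⁆)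
          ∎
      term : ∀ i → ∂-term (h e) σ i ≡ ∂-term e (σ - u) i
      term i with i ≟ u
      ... | yes refl = term-u
      ... | no i≢u   = cong₂ (λ b x → not b ∧ x) (sym (lookup∘-′ σ i≢u)) (begin
        h e (σ ∪ ⁅ i ⁆)
          ≡⟨ h-cone e (σ ∪ ⁅ i ⁆) (lookup∘∪⁅⁆-true σ i σ[u]) (lookup∘∪⁅⁆-true σ i σ[v]) ⟩
        outsideK e ((σ ∪ ⁅ i ⁆) - u)
          ≡⟨ cong (outsideK e) (p∪⁅x⁆-y≡p-y∪⁅x⁆ i≢u) ⟩
        outsideK e ((σ - u) ∪ ⁅ i ⁆)
          ≡⟨ outsideK-∉K e (σ-u∉K ∘ downClosed (p⊆p∪q ⁅ i ⁆)) ⟩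
        e ((σ - u) ∪ ⁅ i ⁆)
          ∎)

    ∂h≡0 : ∀ {σ} → lookup σ u ≡ true → lookup σ v ≡ true → K (σ - u) → ¬ K σ → ∂ (h e) σ ≡ false
    ∂h≡0 {σ} σ[u] σ[v] Kσ-u σ∉K = ∂-vanishes (h e) σ λ i σ[i] →
      trans (h-cone e (σ ∪ ⁅ i ⁆) (lookup∘∪⁅⁆-true σ i σ[u]) (lookup∘∪⁅⁆-true σ i σ[v]))
            (outsideK-vanishes λ (_ , lift∈K) →
               σ∉K (admissible-face cK adm (lookup⇒[]= u σ σ[u]) (lookup⇒[]= v σ σ[v]) (lookup≡false⇒∉ σ[i])
                                    Kσ-u (subst K (lift≡σ-v∪i i σ[i]) lift∈K)))
      where
      lift≡σ-v∪i : ∀ i → lookup σ i ≡ false → ((((σ ∪ ⁅ i ⁆) - u) - v) ∪ ⁅ u ⁆) ≡ (σ - v) ∪ ⁅ i ⁆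
      lift≡σ-v∪i i σ[i] = trans (p-x-y∪⁅x⁆≡p-y u≢v (lookup∘∪⁅⁆-true σ i σ[u]))
                                (p∪⁅x⁆-y≡p-y∪⁅x⁆ λ { refl → contradiction (trans (sym σ[v]) σ[i]) λ () })

    perturb-vanishes : ∀ σ → ¬ K σ → perturb e σ ≡ false
    perturb-vanishes σ σ∉K with u ∈? σ | v ∈? σ
    ... | no u∉σ  | _ =
      trans (perturb-off-u (∉⇒lookup≡false u∉σ)) (trans (cong (e σ xor_) (outsideK-∉K e σ∉K)) (xor-same (e σ)))
    ... | yes u∈σ | no v∉σ =
      trans (perturb-on-u-off-v σ[u] σ[v]) (outsideK-vanishes λ (_ , lift∈K) → σ∉K (subst K lift≡σ lift∈K))
      where
      σ[u] = []=⇒lookup u∈σ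
      σ[v] = ∉⇒lookup≡false v∉σ
      lift≡σ : ((((σ ∪ ⁅ v ⁆) - u) - v) ∪ ⁅ u ⁆) ≡ σ
      lift≡σ = trans (p-x-y∪⁅x⁆≡p-y u≢v (lookup∘∪⁅⁆-true σ v σ[u])) (p∪⁅x⁆-x≡p σ[v])
    ... | yes u∈σ | yes v∈σ = on-cone ([]=⇒lookup u∈σ) ([]=⇒lookup v∈σ) (decide (σ - u))
      where
      on-cone : lookup σ u ≡ true → lookup σ v ≡ true → Dec (K (σ - u)) → perturb e σ ≡ false
      on-cone σ[u] σ[v] (no σ-u∉K) = trans (perturb-on-u σ[u]) (trans
        (cong₂ _xor_ (∂h≡∂[σ-u] σ[u] σ[v] σ-u∉K)
                     (trans (h-cone (∂ e) σ σ[u] σ[v]) (outsideK-∉K (∂ e) σ-u∉K)))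
        (xor-same (∂ e (σ - u))))
      on-cone σ[u] σ[v] (yes Kσ-u) = trans (perturb-on-u σ[u])
        (cong₂ _xor_ (∂h≡0 σ[u] σ[v] Kσ-u σ∉K) (trans (h-cone (∂ e) σ σ[u] σ[v]) (outsideK-∈K (∂ e) Kσ-u)))

    perturb-into-K : Supported K (perturb e)
    perturb-into-K σ Fe[σ] =
      decidable-stable (decide σ) λ σ∉K → contradiction (trans (sym Fe[σ]) (perturb-vanishes σ σ∉K)) λ ()

    perturb-kernel : perturb e ≈ (λ _ → false) → e ≈ (λ _ → false)
    perturb-kernel Fe≈0 σ with lookup σ u in σ[u]
    ... | true  = e-on-u σ[u]
    ... | false = begin
      e σ                   ≡⟨ xor-identityʳ (e σ) ⟨
      e σ xor false         ≡⟨ cong (e σ xor_) outsideK-e[σ] ⟨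
      e σ xor outsideK e σ  ≡⟨ perturb-off-u σ[u] ⟨
      perturb e σ           ≡⟨ Fe≈0 σ ⟩
      false                 ∎
      where
      open ≡-Reasoning
      outsideK-e[σ] : outsideK e σ ≡ false
      outsideK-e[σ] with lookup σ v in σ[v]
      ... | false = outsideK-off-v σ[v]
      ... | true  = begin
        outsideK e σ                  ≡⟨ cong (outsideK e) contract-lift≡σ ⟨
        outsideK e ((ρ ∪ ⁅ v ⁆) - u)  ≡⟨ perturb-on-u-off-v (lookup∘∪⁅⁆ (σ - v) u) ρ[v] ⟨
        perturb e ρ                   ≡⟨ Fe≈0 ρ ⟩
        false                         ∎
        where
        ρ = (σ - v) ∪ ⁅ u ⁆
        ρ[v] : lookup ρ v ≡ false
        ρ[v] = trans (lookup∘∪⁅⁆′ (σ - v) (u≢v ∘ sym)) (lookup∘- σ v)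
        contract-lift≡σ : (ρ ∪ ⁅ v ⁆) - u ≡ σ
        contract-lift≡σ = trans (p∪⁅x⁆∪⁅y⁆-x≡p∪⁅y⁆ u≢v (trans (lookup∘-′ σ u≢v) σ[u])) (p-x∪⁅x⁆≡p σ[v])

  contraction-chainMap : Σ (ChainMap (Contraction K u v) K) Injective
  contraction-chainMap = record
    { f         = λ _ → perturb
    ; f-cong    = λ _ _ _ _ _ → perturb-cong
    ; f-into    = λ _ e e∈ σ Fe[σ] →
        perturb-into-K (chain-faces e∈) σ Fe[σ] , perturb-size (chain-sizes e∈) σ Fe[σ]
    ; f-linear  = λ _ c d _ _ → perturb-⊕ c d
    ; f-commute = λ _ c _ → perturb-∂ c
    } , injective
    where
    xor≡false⇒≡ : ∀ x y → x xor y ≡ false → x ≡ y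
    xor≡false⇒≡ false false _ = refl
    xor≡false⇒≡ true  true  _ = refl
    injective : ∀ k c d → IsChain (Contraction K u v) k c → IsChain (Contraction K u v) k d →
                perturb c ≈ perturb d → c ≈ d
    injective k c d c∈ d∈ Fc≈Fd σ = xor≡false⇒≡ (c σ) (d σ)
      (perturb-kernel (⊕-supported (chain-faces c∈) (chain-faces d∈)) F[c⊕d]≈0 σ)
      where
      F[c⊕d]≈0 : perturb (c ⊕ d) ≈ (λ _ → false)
      F[c⊕d]≈0 τ = trans (perturb-⊕ c d τ) (trans (cong (_xor perturb d τ) (Fc≈Fd τ)) (xor-same (perturb d τ)))

move⇒chainMap : ∀ {K K′ : FaceSet n} → IsComplex K → Move K K′ → IsComplex K′ × Σ (ChainMap K′ K) Injective
move⇒chainMap cK (delete cK′ K′⊆K) = cK′ , inclusion K′⊆K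
move⇒chainMap cK (contract u v adm K′⇔K/uv) =
  cK′ , compose cK′ cK/uv (inclusion (λ T → Equivalence.to (K′⇔K/uv T)))
                          (ContractionChainMap.contraction-chainMap cK adm)
  where
  cK/uv = contraction-isComplex cK (proj₁ (proj₂ (proj₂ adm)))
  cK′   = isComplex-⇔ K′⇔K/uv cK/uv

corollary3p3 : ∀ {n : ℕ} (H K : FaceSet n) → IsComplex H → IsComplex K →
    H < K → Σ (ChainMap H K) Injective
corollary3p3 H K cH cK ε = inclusion (λ _ → id)
corollary3p3 H K cH cK (move ◅ moves) =
  let cK′ , φ = move⇒chainMap cK move in compose cH cK′ (corollary3p3 H _ cH cK′ moves) φ
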